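{- The scheduling game under the EQUI policy (on unrelated machines, hence on all the special machine models) is an exact potential game: for every instance there is a function $\Phi$ on strategy profiles such that for every profile $\sigma$, every job $t$ and every machine $b$, if $\sigma'$ is obtained from $\sigma$ by moving job $t$ to machine $b$ (all other jobs unchanged), then $\Phi(\sigma')-\Phi(\sigma)=c_t(\sigma')-c_t(\sigma)$. In particular every better-response move strictly decreases $\Phi$.
   Context: Scheduling game: $n$ jobs (players), $m$ machines, processing time $p_{i,j}>0$ of job $i$ on machine $j$ (unrelated machines: arbitrary positive values). A strategy profile is a map $\sigma:\{1,\dots,n\}\to\{1,\dots,m\}$. Under the EQUI policy each machine runs all its jobs in parallel by time-multiplexing, giving every unfinished job an equal share of the processor; consequently the cost (completion time) of job $i$ with $\sigma(i)=j$ is $c_i(\sigma)=\sum_{i':\ \sigma(i')=j}\min\{p_{i,j},p_{i',j}\}$ (the sum includes $i'=i$). A better-response move is a change of machine by a single job, all others fixed, that strictly decreases that job's cost.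
   Formalization: The processing times $p_{i,j}$ are positive rationals, and the potential Φ takes rational values. -}

module Defs where

open import Data.Nat using (ℕ; zero; suc)
open import Data.Fin using (Fin; zero; suc; _≟_)
open import Data.Rational using (ℚ; 0ℚ; _+_; _⊓_)
open import Relation.Nullary using (yes; no)

∑ : {n : ℕ} → (Fin n → ℚ) → ℚ
∑ {zero}  f = 0ℚ
∑ {suc n} f = f zero + ∑ (λ i → f (suc i))

-- A strategy profile: each job chooses a machine
Profile : ℕ → ℕ → Set
Profile n m = Fin n → Fin m

cost : {n m : ℕ} → (Fin n → Fin m → ℚ) → Profile n m → Fin n → ℚ
cost p σ i = ∑ (λ i' → term i')
  where
  term : _ → ℚ
  term i' with σ i' ≟ σ i
  ... | yes _ = p i (σ i) ⊓ p i' (σ i)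
  ... | no  _ = 0ℚ

move : {n m : ℕ} → Profile n m → Fin n → Fin m → Profile n m
move σ t b t' with t' ≟ t
... | yes _ = b
... | no  _ = σ t'

module Submission where

open import Defs
open import Data.Nat using (ℕ; zero; suc)
open import Data.Fin using (Fin; zero; suc; _≟_)
open import Data.Fin.Properties using (suc-injective)
open import Data.Rational using (ℚ; 0ℚ; _<_; _-_; _+_)
open import Data.Rational.Properties using (+-0-commutativeMonoid; +-assoc; +-monoˡ-<; ⊓-comm)
open import Data.Rational.Solver using (module +-*-Solver)
open import Algebra.Bundles using (CommutativeMonoid)
open import Algebra.Properties.CommutativeSemigroup
  (CommutativeMonoid.commutativeSemigroup +-0-commutativeMonoid) using (interchange; xy∙z≈zy∙x)
open import Data.Product using (Σ; _×_; _,_)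
open import Relation.Nullary using (yes; no; ¬_; contradiction)
open import Relation.Binary.PropositionalEquality
  using (_≡_; refl; sym; trans; cong; cong₂; subst₂; module ≡-Reasoning)

-- The EQUI potential is the upper-triangular half ∑_{i ≤ k} of the symmetric "delay" matrix
-- d_{ik} = [σ i = σ k] · min (p_{i,σ i}) (p_{k,σ i}), whose rows sum to the costs. Moving job t
-- changes only row and column t of d; by symmetry the triangle picks up each changed entry exactly
-- once, so its change equals the change of the row sum of t, i.e. of t's cost.

∑-cong : ∀ {n} {f g : Fin n → ℚ} → (∀ i → f i ≡ g i) → ∑ f ≡ ∑ g
∑-cong {zero}  eq = refl
∑-cong {suc n} eq = cong₂ _+_ (eq zero) (∑-cong (λ i → eq (suc i)))

∑-exchange : ∀ {n} (f g : Fin n → ℚ) s → (∀ k → ¬ k ≡ s → f k ≡ g k) → ∑ f + g s ≡ ∑ g + f s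
∑-exchange f g zero eq
  rewrite ∑-cong {f = λ k → f (suc k)} {g = λ k → g (suc k)} (λ k → eq (suc k) (λ ()))
  = xy∙z≈zy∙x (f zero) _ (g zero)
∑-exchange f g (suc s) eq = begin
  (f zero + ∑ (λ k → f (suc k))) + g (suc s)  ≡⟨ +-assoc (f zero) _ _ ⟩
  f zero + (∑ (λ k → f (suc k)) + g (suc s))  ≡⟨ cong₂ _+_ (eq zero (λ ())) tail ⟩
  g zero + (∑ (λ k → g (suc k)) + f (suc s))  ≡⟨ sym (+-assoc (g zero) _ _) ⟩
  (g zero + ∑ (λ k → g (suc k))) + f (suc s)  ∎
  where
  open ≡-Reasoning
  tail = ∑-exchange (λ k → f (suc k)) (λ k → g (suc k)) s
           (λ k k≢s → eq (suc k) (λ e → k≢s (suc-injective e)))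

Matrix : ℕ → Set
Matrix n = Fin n → Fin n → ℚ

Symmetric : ∀ {n} → Matrix n → Set
Symmetric w = ∀ i k → w i k ≡ w k i

AgreeOff : ∀ {n} → Fin n → Matrix n → Matrix n → Set
AgreeOff t w w′ = ∀ i k → ¬ i ≡ t → ¬ k ≡ t → w i k ≡ w′ i k

lower : ∀ {n} → Matrix (suc n) → Matrix n
lower w i k = w (suc i) (suc k)

triangle : ∀ {n} → Matrix n → ℚ
triangle {zero}  w = 0ℚ
triangle {suc n} w = ∑ (w zero) + triangle (lower w)

triangle-cong : ∀ {n} {w w′ : Matrix n} → (∀ i k → w i k ≡ w′ i k) → triangle w ≡ triangle w′
triangle-cong {zero}  eq = refl
triangle-cong {suc n} eq =
  cong₂ _+_ (∑-cong (eq zero)) (triangle-cong (λ i k → eq (suc i) (suc k)))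

triangle-exchange : ∀ {n} (w w′ : Matrix n) t → Symmetric w → Symmetric w′ → AgreeOff t w w′ →
  triangle w′ + ∑ (w t) ≡ triangle w + ∑ (w′ t)
triangle-exchange {suc n} w w′ zero _ _ agree
  rewrite triangle-cong {w = lower w′} {w′ = lower w} (λ i k → sym (agree (suc i) (suc k) (λ ()) (λ ())))
  = xy∙z≈zy∙x (∑ (w′ zero)) _ (∑ (w zero))
triangle-exchange {suc n} w w′ (suc t) sym-w sym-w′ agree = begin
  (∑ (w′ zero) + triangle (lower w′)) + (w (suc t) zero + ∑ (lower w t))
    ≡⟨ interchange (∑ (w′ zero)) _ _ _ ⟩
  (∑ (w′ zero) + w (suc t) zero) + (triangle (lower w′) + ∑ (lower w t))
    ≡⟨ cong₂ _+_ first-row rest ⟩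
  (∑ (w zero) + w′ (suc t) zero) + (triangle (lower w) + ∑ (lower w′ t))
    ≡⟨ interchange (∑ (w zero)) _ _ _ ⟩
  (∑ (w zero) + triangle (lower w)) + (w′ (suc t) zero + ∑ (lower w′ t))  ∎
  where
  open ≡-Reasoning
  first-row : ∑ (w′ zero) + w (suc t) zero ≡ ∑ (w zero) + w′ (suc t) zero
  first-row
    rewrite sym-w (suc t) zero | sym-w′ (suc t) zero
    = ∑-exchange (w′ zero) (w zero) (suc t) (λ k k≢t → sym (agree zero k (λ ()) k≢t))
  rest : triangle (lower w′) + ∑ (lower w t) ≡ triangle (lower w) + ∑ (lower w′ t)
  rest = triangle-exchange (lower w) (lower w′) t
    (λ i k → sym-w (suc i) (suc k)) (λ i k → sym-w′ (suc i) (suc k))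
    (λ i k i≢t k≢t → agree (suc i) (suc k) (λ e → i≢t (suc-injective e)) (λ e → k≢t (suc-injective e)))

-- The summand of cost is a with-function local to Defs and cannot be named directly;
-- unification against cost names it here, so that cost p σ i is ∑ (delay p σ i) by refl.
mutual
  delay : ∀ {n m} → (Fin n → Fin m → ℚ) → Profile n m → Matrix n
  delay p σ i = _

  cost≡∑-delay : ∀ {n m} (p : Fin n → Fin m → ℚ) σ i → cost p σ i ≡ ∑ (delay p σ i)
  cost≡∑-delay p σ i = refl

delay-sym : ∀ {n m} (p : Fin n → Fin m → ℚ) σ → Symmetric (delay p σ)
delay-sym p σ i k with σ k ≟ σ i | σ i ≟ σ k
... | yes σk≡σi | yes _   rewrite σk≡σi = ⊓-comm (p i (σ i)) (p k (σ i))
... | yes σk≡σi | no σi≢σk = contradiction (sym σk≡σi) σi≢σk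
... | no σk≢σi  | yes σi≡σk = contradiction (sym σi≡σk) σk≢σi
... | no _      | no _    = refl

delay-local : ∀ {n m} (p : Fin n → Fin m → ℚ) σ τ i k → σ i ≡ τ i → σ k ≡ τ k →
  delay p σ i k ≡ delay p τ i k
delay-local p σ τ i k σi≡τi σk≡τk with σ k ≟ σ i | τ k ≟ τ i
... | yes _ | yes _ rewrite σi≡τi = refl
... | no _  | no _  = refl
... | yes σk≡σi | no τk≢τi = contradiction (trans (sym σk≡τk) (trans σk≡σi σi≡τi)) τk≢τi
... | no σk≢σi  | yes τk≡τi = contradiction (trans σk≡τk (trans τk≡τi (sym σi≡τi))) σk≢σi

move-other : ∀ {n m} (σ : Profile n m) t b k → ¬ k ≡ t → move σ t b k ≡ σ k
move-other σ t b k k≢t with k ≟ t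
... | yes k≡t = contradiction k≡t k≢t
... | no _    = refl

potential : ∀ {n m} → (Fin n → Fin m → ℚ) → Profile n m → ℚ
potential p σ = triangle (delay p σ)

potential-exchange : ∀ {n m} (p : Fin n → Fin m → ℚ) σ t b →
  potential p (move σ t b) + cost p σ t ≡ potential p σ + cost p (move σ t b) t
potential-exchange p σ t b =
  triangle-exchange (delay p σ) (delay p (move σ t b)) t (delay-sym p σ) (delay-sym p (move σ t b))
    (λ i k i≢t k≢t → delay-local p σ (move σ t b) i k
       (sym (move-other σ t b i i≢t)) (sym (move-other σ t b k k≢t)))

open +-*-Solver

exchange⇒-≡ : ∀ a b c d → a + d ≡ b + c → a - b ≡ c - d
exchange⇒-≡ a b c d eq = begin
  a - b              ≡⟨ solve 4 (λ a b c d → a :- b := (a :+ d) :- (b :+ d)) refl a b c d ⟩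
  (a + d) - (b + d)  ≡⟨ cong (_- (b + d)) eq ⟩
  (b + c) - (b + d)  ≡⟨ solve 4 (λ a b c d → (b :+ c) :- (b :+ d) := c :- d) refl a b c d ⟩
  c - d              ∎
  where open ≡-Reasoning

exchange⇒< : ∀ a b c d → a + d ≡ b + c → c < d → a < b
exchange⇒< a b c d eq c<d = subst₂ _<_ c+[b-d]≡a d+[b-d]≡b (+-monoˡ-< (b - d) c<d)
  where
  open ≡-Reasoning
  c+[b-d]≡a : c + (b - d) ≡ a
  c+[b-d]≡a = begin
    c + (b - d)        ≡⟨ solve 3 (λ b c d → c :+ (b :- d) := (b :+ c) :- d) refl b c d ⟩
    (b + c) - d        ≡⟨ cong (_- d) (sym eq) ⟩
    (a + d) - d        ≡⟨ solve 2 (λ a d → (a :+ d) :- d := a) refl a d ⟩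
    a                  ∎
  d+[b-d]≡b : d + (b - d) ≡ b
  d+[b-d]≡b = solve 2 (λ b d → d :+ (b :- d) := b) refl b d

lemma4 : (n m : ℕ) (p : Fin n → Fin m → ℚ) → (∀ i j → 0ℚ < p i j) →
    Σ (Profile n m → ℚ) (λ Φ →
      (∀ σ t b → Φ (move σ t b) - Φ σ ≡ cost p (move σ t b) t - cost p σ t)
      × (∀ σ t b → cost p (move σ t b) t < cost p σ t → Φ (move σ t b) < Φ σ))
lemma4 n m p _ = potential p , exact , decreasing
  where
  exact : ∀ σ t b → potential p (move σ t b) - potential p σ ≡ cost p (move σ t b) t - cost p σ t
  exact σ t b = exchange⇒-≡ (potential p (move σ t b)) (potential p σ) (cost p (move σ t b) t) (cost p σ t)
    (potential-exchange p σ t b)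
  decreasing : ∀ σ t b → cost p (move σ t b) t < cost p σ t → potential p (move σ t b) < potential p σ
  decreasing σ t b = exchange⇒< (potential p (move σ t b)) (potential p σ) (cost p (move σ t b) t) (cost p σ t)
    (potential-exchange p σ t b)
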